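{- Let $\Sigma$ be a totally ordered alphabet with $\sigma=|\Sigma|$ and $w\in\Sigma^n$. At most $\binom{\sigma}{2}n$ fragments of $w$ (pairs of positions $(i,j)$) are order-preserving squares but not ordinary squares.
   Context: For a word $u$, $\mathrm{Alph}(u)$ is the set of letters occurring in $u$. An order-preserving square is a word $uv$ with $u,v$ nonempty, $|u|=|v|$, and a strictly increasing bijection $f:\mathrm{Alph}(u)\to\mathrm{Alph}(v)$ such that $v[t]=f(u[t])$ for all $t=1,\ldots,|u|$. An ordinary square is a word $uu$ with $u$ nonempty. $w[i..j]$ denotes the fragment $w[i]\cdots w[j]$. -}

module Defs where

open import Data.Nat using (ℕ; suc; _∸_; _<_)
open import Data.Fin using (Fin) renaming (_<_ to _<ᶠ_)
open import Data.List using (List; []; _++_; length; take; drop)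
open import Data.List.Membership.Propositional using (_∈_)
open import Data.List.Relation.Binary.Pointwise using (Pointwise)
open import Data.Vec using (Vec; toList)
open import Data.Product using (Σ; ∃; _×_)
open import Relation.Binary.PropositionalEquality using (_≡_; _≢_)

-- Alphabet Σ of size σ, totally ordered: represented by Fin σ with its natural order.
Word : ℕ → Set
Word σ = List (Fin σ)

-- f : Alph(u) → Alph(v) is a strictly increasing bijection with v[t] = f(u[t]).
-- f is given as a function on Fin σ whose restriction to Alph(u) is the map.
IsOPMap : ∀ {σ} → Word σ → Word σ → (Fin σ → Fin σ) → Set
IsOPMap {σ} u v f =
  (∀ a → a ∈ u → f a ∈ v)
  × (∀ b → b ∈ v → Σ (Fin σ) λ a → a ∈ u × f a ≡ b)
  × (∀ a b → a ∈ u → b ∈ u → a <ᶠ b → f a <ᶠ f b)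
  × Pointwise (λ x y → y ≡ f x) u v

OPSquare : ∀ {σ} → Word σ → Set
OPSquare {σ} x = Σ (Word σ) λ u → Σ (Word σ) λ v →
  x ≡ u ++ v × length u ≡ length v × 0 < length u ×
  Σ (Fin σ → Fin σ) λ f → IsOPMap u v f

Square : ∀ {σ} → Word σ → Set
Square {σ} x = Σ (Word σ) λ u → u ≢ [] × x ≡ u ++ u

-- fragment w[i..j] (0-based positions, inclusive)
fragment : ∀ {σ n} → Vec (Fin σ) n → ℕ → ℕ → Word σ
fragment w i j = take (suc j ∸ i) (drop i (toList w))

-- An order-preserving square uv with u ≠ v has an increasing letter map f with v = f(u).
-- f cannot map Alph(u) into itself, since an increasing self-map of a finite chain is the
-- identity.  So some position t of u is the first with f(u[t]) ∉ Alph(u); then a = u[t] does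
-- not occur before t (else f(a) would occur in v before t, inside Alph(u)), and b = f(a) does
-- not occur in u or in v before t.  Hence in the suffix of w where the square starts, the
-- distinct letters a and b first occur exactly |u| positions apart.  A fragment is therefore
-- determined by its start and the pair {a, b}, which leaves at most n · C(σ, 2) fragments.

module Submission where

open import Defs
open import Data.Nat using (ℕ; _≤_; _<_; _*_)
open import Data.Nat.Combinatorics using (_C_)
open import Data.Fin using (Fin)
open import Data.Vec using (Vec)
open import Data.List using (List; length)
open import Data.List.Relation.Unary.All using (All)
open import Data.List.Relation.Unary.Unique.Propositional using (Unique)
open import Data.Product using (_×_; _,_)
open import Relation.Nullary using (¬_)

open import Level using (0ℓ)
open import Data.Nat using (suc; z<s; _+_; _∸_; _⊓_; ∣_-_∣; _≤′_; ≤′-reflexive; ≤′-step)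
open import Data.Nat.Properties
  using (_≤?_; ≰⇒>; <⇒≱; ≤-antisym; <⇒≢; <-irrefl; <-cmp; <-≤-trans; ≤-<-trans; ≤-refl; ≤⇒≤′; m≤m+n; m<m+n;
         m≤n⇒m≤1+n; m≤n⇒m⊓n≡m; +-comm; +-monoʳ-<; +-cancelˡ-≡; *-comm; ∸-monoˡ-≤; ∸-cancelʳ-≡; suc-injective;
         ∣m-m+n∣≡n; ∣-∣-comm; module ≤-Reasoning)
open import Data.Nat.Combinatorics using (nCk+nC[k+1]≡[n+1]C[k+1]; nC1≡n)
open import Data.Fin using (toℕ; fromℕ<; combine)
  renaming (zero to fzero; suc to fsuc; _≟_ to _≟ᶠ_; _<_ to _<ᶠ_; _≤_ to _≤ᶠ_)
open import Data.Fin.Properties using (toℕ-injective; toℕ<n; fromℕ<-injective; combine-injective; injective⇒≤)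
open import Data.Fin.Induction using () renaming (<-wellFounded to <ᶠ-wellFounded; >-wellFounded to >ᶠ-wellFounded)
open import Data.Vec using (toList)
open import Data.Vec.Properties using (length-toList)
open import Data.List using ([]; _∷_; _++_; map; take; drop; lookup)
open import Data.List.Properties
  using (++-assoc; length-++; length-map; length-++-sucʳ; length-take; length-drop; map-++; map-id-local;
         take++drop≡id; ∷-injectiveʳ)
open import Data.List.Membership.Propositional using (_∈_; _∉_)
open import Data.List.Membership.Propositional.Properties using (∈-++⁻; ∈-lookup)
open import Data.List.Relation.Unary.Any using (here; there; any?)
open import Data.List.Relation.Unary.All using (tabulate) renaming (lookup to All-lookup; map to All-map)
open import Data.List.Relation.Unary.All.Properties using () renaming (map⁺ to All-map⁺)
open import Data.List.Relation.Unary.AllPairs using (_∷_)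
open import Data.List.Relation.Unary.First as First using (first)
open import Data.List.Relation.Unary.First.Properties using (toView)
open import Data.List.Relation.Binary.Pointwise using (Pointwise; []; _∷_)
open import Data.Product using (∃₂; proj₁; proj₂)
open import Data.Sum using (inj₁; inj₂)
open import Function using (_∘_)
open import Induction.WellFounded using (module All)
open import Relation.Nullary using (yes; no; contradiction)
open import Relation.Nullary.Decidable using (toSum)
open import Relation.Unary using (Pred)
open import Relation.Binary.PropositionalEquality using (_≡_; _≢_; refl; sym; trans; cong; cong₂; subst; module ≡-Reasoning)
open import Relation.Binary.Definitions using (tri<; tri≈; tri>)

module _ {σ : ℕ} (S : Pred (Fin σ) 0ℓ) (f : Fin σ → Fin σ)
         (f-closed : ∀ {a} → S a → S (f a))
         (f-increasing : ∀ a b → S a → S b → a <ᶠ b → f a <ᶠ f b) where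

  increasing⇒inflationary : ∀ a → S a → a ≤ᶠ f a
  increasing⇒inflationary = All.wfRec <ᶠ-wellFounded 0ℓ (λ a → S a → a ≤ᶠ f a) step
    where
      step : ∀ a → (∀ {b} → b <ᶠ a → S b → b ≤ᶠ f b) → S a → a ≤ᶠ f a
      step a rec a∈S with toℕ a ≤? toℕ (f a)
      ... | yes a≤fa = a≤fa
      ... | no a≰fa = contradiction (rec fa<a (f-closed a∈S)) (<⇒≱ (f-increasing _ _ (f-closed a∈S) a∈S fa<a))
        where
          fa<a : f a <ᶠ a
          fa<a = ≰⇒> a≰fa

  increasing⇒deflationary : ∀ a → S a → f a ≤ᶠ a
  increasing⇒deflationary = All.wfRec >ᶠ-wellFounded 0ℓ (λ a → S a → f a ≤ᶠ a) step
    where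
      step : ∀ a → (∀ {b} → a <ᶠ b → S b → f b ≤ᶠ b) → S a → f a ≤ᶠ a
      step a rec a∈S with toℕ (f a) ≤? toℕ a
      ... | yes fa≤a = fa≤a
      ... | no fa≰a = contradiction (rec a<fa (f-closed a∈S)) (<⇒≱ (f-increasing _ _ a∈S (f-closed a∈S) a<fa))
        where
          a<fa : a <ᶠ f a
          a<fa = ≰⇒> fa≰a

  increasing⇒fixed : ∀ a → S a → f a ≡ a
  increasing⇒fixed a a∈S =
    toℕ-injective (≤-antisym (increasing⇒deflationary a a∈S) (increasing⇒inflationary a a∈S))

[1+n]C2≡nC2+n : ∀ n → suc n C 2 ≡ n C 2 + n
[1+n]C2≡nC2+n n = begin
  suc n C 2         ≡⟨ nCk+nC[k+1]≡[n+1]C[k+1] n 1 ⟨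
  n C 1 + n C 2     ≡⟨ cong (_+ n C 2) (nC1≡n n) ⟩
  n + n C 2         ≡⟨ +-comm n (n C 2) ⟩
  n C 2 + n         ∎
  where open ≡-Reasoning

C2-mono-≤ : ∀ {m n} → m ≤ n → m C 2 ≤ n C 2
C2-mono-≤ = mono′ ∘ ≤⇒≤′
  where
    mono′ : ∀ {m n} → m ≤′ n → m C 2 ≤ n C 2
    mono′ (≤′-reflexive refl) = ≤-refl
    mono′ {m} (≤′-step {n} m≤′n) = begin
      m C 2       ≤⟨ mono′ m≤′n ⟩
      n C 2       ≤⟨ m≤m+n (n C 2) n ⟩
      n C 2 + n   ≡⟨ [1+n]C2≡nC2+n n ⟨
      suc n C 2   ∎
      where open ≤-Reasoning

-- Pairs l < h are numbered row by row: row h occupies [h C 2, (1 + h) C 2).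
hC2+l<mC2 : ∀ {l h m} → l < h → h < m → h C 2 + l < m C 2
hC2+l<mC2 {l} {h} {m} l<h h<m = begin-strict
  h C 2 + l     <⟨ +-monoʳ-< (h C 2) l<h ⟩
  h C 2 + h     ≡⟨ [1+n]C2≡nC2+n h ⟨
  suc h C 2     ≤⟨ C2-mono-≤ h<m ⟩
  m C 2         ∎
  where open ≤-Reasoning

hC2+l-injective : ∀ {l h l′ h′} → l < h → l′ < h′ → h C 2 + l ≡ h′ C 2 + l′ → h ≡ h′ × l ≡ l′
hC2+l-injective {l} {h} {l′} {h′} l<h l′<h′ eq with <-cmp h h′
... | tri< h<h′ _ _ = contradiction eq (<⇒≢ (<-≤-trans (hC2+l<mC2 l<h h<h′) (m≤m+n (h′ C 2) l′)))
... | tri≈ _ refl _ = refl , +-cancelˡ-≡ (h C 2) l l′ eq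
... | tri> _ _ h′<h = contradiction (sym eq) (<⇒≢ (<-≤-trans (hC2+l<mC2 l′<h′ h′<h) (m≤m+n (h C 2) l)))

pairIndex : ∀ {σ} {lo hi : Fin σ} → lo <ᶠ hi → Fin (σ C 2)
pairIndex {hi = hi} lo<hi = fromℕ< (hC2+l<mC2 lo<hi (toℕ<n hi))

pairIndex-injective : ∀ {σ} {lo hi lo′ hi′ : Fin σ} (lo<hi : lo <ᶠ hi) (lo′<hi′ : lo′ <ᶠ hi′) →
  pairIndex lo<hi ≡ pairIndex lo′<hi′ → lo ≡ lo′ × hi ≡ hi′
pairIndex-injective lo<hi lo′<hi′ eq
  with hi≡hi′ , lo≡lo′ ← hC2+l-injective lo<hi lo′<hi′ (fromℕ<-injective _ _ _ _ eq) =
  toℕ-injective lo≡lo′ , toℕ-injective hi≡hi′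

Pointwise-graph⇒map : ∀ {A B : Set} {f : A → B} {xs ys} →
  Pointwise (λ x y → y ≡ f x) xs ys → ys ≡ map f xs
Pointwise-graph⇒map [] = refl
Pointwise-graph⇒map (refl ∷ rs) = cong (_ ∷_) (Pointwise-graph⇒map rs)

Unique⇒lookup-injective : ∀ {A : Set} {xs : List A} → Unique xs → ∀ i j → lookup xs i ≡ lookup xs j → i ≡ j
Unique⇒lookup-injective (_ ∷ _) fzero fzero _ = refl
Unique⇒lookup-injective (x∉xs ∷ _) fzero (fsuc j) eq = contradiction eq (All-lookup x∉xs (∈-lookup j))
Unique⇒lookup-injective (x∉xs ∷ _) (fsuc i) fzero eq = contradiction (sym eq) (All-lookup x∉xs (∈-lookup i))
Unique⇒lookup-injective (_ ∷ xs-unique) (fsuc i) (fsuc j) eq = cong fsuc (Unique⇒lookup-injective xs-unique i j eq)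

length≤-of-injective-code : ∀ {A : Set} {P : Pred A 0ℓ} {N} {xs : List A} (code : ∀ {x} → P x → Fin N) →
  (∀ {x y} (px : P x) (py : P y) → code px ≡ code py → x ≡ y) → Unique xs → All P xs → length xs ≤ N
length≤-of-injective-code code code-injective xs-unique pxs =
  injective⇒≤ {f = λ i → code (All-lookup pxs (∈-lookup i))}
    λ {i} {j} eq → Unique⇒lookup-injective xs-unique i j (code-injective _ _ eq)

FirstOccurrenceAt : ∀ {A : Set} → List A → A → ℕ → Set
FirstOccurrenceAt L a p = ∃₂ λ xs ys → L ≡ xs ++ a ∷ ys × a ∉ xs × length xs ≡ p

first-occurrence-unique : ∀ {A : Set} {L : List A} {a p q} →
  FirstOccurrenceAt L a p → FirstOccurrenceAt L a q → p ≡ q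
first-occurrence-unique (xs , ys , refl , a∉xs , refl) (xs′ , ys′ , eq , a∉xs′ , refl) =
  prefix-length xs xs′ eq a∉xs a∉xs′
  where
    prefix-length : ∀ {a} xs xs′ {ys ys′} → xs ++ a ∷ ys ≡ xs′ ++ a ∷ ys′ →
      a ∉ xs → a ∉ xs′ → length xs ≡ length xs′
    prefix-length [] [] _ _ _ = refl
    prefix-length [] (_ ∷ _) refl _ a∉ = contradiction (here refl) a∉
    prefix-length (_ ∷ _) [] refl a∉ _ = contradiction (here refl) a∉
    prefix-length (_ ∷ xs) (_ ∷ xs′) eq a∉ a∉′ =
      cong suc (prefix-length xs xs′ (∷-injectiveʳ eq) (a∉ ∘ there) (a∉′ ∘ there))

record FirstOccurrenceGap {σ} (L : Word σ) (k : ℕ) : Set where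
  field
    lo hi         : Fin σ
    lo<hi         : lo <ᶠ hi
    pos-lo pos-hi : ℕ
    first-lo      : FirstOccurrenceAt L lo pos-lo
    first-hi      : FirstOccurrenceAt L hi pos-hi
    distance      : ∣ pos-lo - pos-hi ∣ ≡ k

first-occurrences⇒gap : ∀ {σ} {L : Word σ} {a b p k} →
  FirstOccurrenceAt L a p → FirstOccurrenceAt L b (p + k) → 0 < k → FirstOccurrenceGap L k
first-occurrences⇒gap {a = a} {b} {p} {k} first-a first-b 0<k with <-cmp (toℕ a) (toℕ b)
... | tri< a<b _ _ = record
  { lo<hi = a<b ; first-lo = first-a ; first-hi = first-b ; distance = ∣m-m+n∣≡n p k }
... | tri> _ _ b<a = record
  { lo<hi = b<a ; first-lo = first-b ; first-hi = first-a
  ; distance = trans (∣-∣-comm (p + k) p) (∣m-m+n∣≡n p k) }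
... | tri≈ _ a≡b _ with refl ← toℕ-injective a≡b =
  contradiction (first-occurrence-unique first-a first-b) (<⇒≢ (m<m+n p 0<k))

gap-length-unique : ∀ {σ} {L : Word σ} {k k′} (g : FirstOccurrenceGap L k) (g′ : FirstOccurrenceGap L k′) →
  FirstOccurrenceGap.lo g ≡ FirstOccurrenceGap.lo g′ → FirstOccurrenceGap.hi g ≡ FirstOccurrenceGap.hi g′ → k ≡ k′
gap-length-unique {k = k} {k′} g g′ refl refl = begin
  k                         ≡⟨ G.distance ⟨
  ∣ G.pos-lo - G.pos-hi ∣   ≡⟨ cong₂ ∣_-_∣ (first-occurrence-unique G.first-lo G′.first-lo)
                                          (first-occurrence-unique G.first-hi G′.first-hi) ⟩
  ∣ G′.pos-lo - G′.pos-hi ∣ ≡⟨ G′.distance ⟩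
  k′                        ∎
  where
    module G = FirstOccurrenceGap g
    module G′ = FirstOccurrenceGap g′
    open ≡-Reasoning

escaping-letter-gap : ∀ {σ} (f : Fin σ → Fin σ) u₁ a u₂ →
  All (λ x → f x ∈ u₁ ++ a ∷ u₂) u₁ → f a ∉ u₁ ++ a ∷ u₂ → ∀ rest → FirstOccurrenceGap ((u₁ ++ a ∷ u₂) ++ map f (u₁ ++ a ∷ u₂) ++ rest) (length (u₁ ++ a ∷ u₂))
escaping-letter-gap {σ} f u₁ a u₂ closed-prefix fa∉u rest =
  first-occurrences⇒gap first-a first-fa (subst (0 <_) (sym (length-++-sucʳ u₁ a u₂)) z<s)
  where
    u : Word σ
    u = u₁ ++ a ∷ u₂
    first-a : FirstOccurrenceAt (u ++ map f u ++ rest) a (length u₁)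
    first-a = u₁ , u₂ ++ map f u ++ rest , ++-assoc u₁ (a ∷ u₂) (map f u ++ rest) ,
              (λ a∈u₁ → fa∉u (All-lookup closed-prefix a∈u₁)) , refl
    fa∉prefix : f a ∉ u ++ map f u₁
    fa∉prefix fa∈ with ∈-++⁻ u fa∈
    ... | inj₁ fa∈u = fa∉u fa∈u
    ... | inj₂ fa∈fu₁ = fa∉u (All-lookup (All-map⁺ {P = _∈ u} closed-prefix) fa∈fu₁)
    split-at-fa : u ++ map f u ++ rest ≡ (u ++ map f u₁) ++ f a ∷ (map f u₂ ++ rest)
    split-at-fa = begin
      u ++ map f u ++ rest                         ≡⟨ cong (λ z → u ++ z ++ rest) (map-++ f u₁ (a ∷ u₂)) ⟩
      u ++ (map f u₁ ++ f a ∷ map f u₂) ++ rest    ≡⟨ cong (u ++_) (++-assoc (map f u₁) (f a ∷ map f u₂) rest) ⟩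
      u ++ map f u₁ ++ f a ∷ map f u₂ ++ rest      ≡⟨ ++-assoc u (map f u₁) (f a ∷ map f u₂ ++ rest) ⟨
      (u ++ map f u₁) ++ f a ∷ (map f u₂ ++ rest)  ∎
      where open ≡-Reasoning
    prefix-length : length (u ++ map f u₁) ≡ length u₁ + length u
    prefix-length = begin
      length (u ++ map f u₁)        ≡⟨ length-++ u ⟩
      length u + length (map f u₁)  ≡⟨ cong (length u +_) (length-map f u₁) ⟩
      length u + length u₁          ≡⟨ +-comm (length u) (length u₁) ⟩
      length u₁ + length u          ∎
      where open ≡-Reasoning
    first-fa : FirstOccurrenceAt (u ++ map f u ++ rest) (f a) (length u₁ + length u)
    first-fa = u ++ map f u₁ , map f u₂ ++ rest , split-at-fa , fa∉prefix , prefix-length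

increasing-image-gap : ∀ {σ} (u : Word σ) (f : Fin σ → Fin σ) →
  (∀ a b → a ∈ u → b ∈ u → a <ᶠ b → f a <ᶠ f b) → map f u ≢ u → ∀ rest →
  FirstOccurrenceGap (u ++ map f u ++ rest) (length u)
increasing-image-gap u f f-increasing fu≢u rest
  with first (λ x → toSum (any? (f x ≟ᶠ_) u)) u
... | inj₂ closed =
  contradiction (map-id-local (tabulate λ {a} → increasing⇒fixed (_∈ u) f (All-lookup closed) f-increasing a)) fu≢u
... | inj₁ fst with toView fst
... | First._++_∷_ {u₁} {a} closed-prefix fa∉u u₂ = escaping-letter-gap f u₁ a u₂ closed-prefix fa∉u rest

length-fragment : ∀ {σ n} (w : Vec (Fin σ) n) i {j} → j < n → length (fragment w i j) ≡ suc j ∸ i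
length-fragment {n = n} w i {j} j<n = begin
  length (take m (drop i (toList w)))   ≡⟨ length-take m (drop i (toList w)) ⟩
  m ⊓ length (drop i (toList w))        ≡⟨ cong (m ⊓_) (length-drop i (toList w)) ⟩
  m ⊓ (length (toList w) ∸ i)           ≡⟨ cong (λ l → m ⊓ (l ∸ i)) (length-toList w) ⟩
  m ⊓ (n ∸ i)                           ≡⟨ m≤n⇒m⊓n≡m (∸-monoˡ-≤ i j<n) ⟩
  m                                     ∎
  where
    m : ℕ
    m = suc j ∸ i
    open ≡-Reasoning

OPNonSquareFragment : ∀ {σ n} → Vec (Fin σ) n → ℕ × ℕ → Set
OPNonSquareFragment {n = n} w (i , j) = i ≤ j × j < n × OPSquare (fragment w i j) × ¬ Square (fragment w i j)

record HalfLengthGap {σ n} (w : Vec (Fin σ) n) (i j : ℕ) : Set where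
  field
    half            : ℕ
    gap             : FirstOccurrenceGap (drop i (toList w)) half
    fragment-length : suc j ∸ i ≡ half + half

opNonSquare⇒half-length-gap : ∀ {σ n} (w : Vec (Fin σ) n) {i j} → OPNonSquareFragment w (i , j) → HalfLengthGap w i j
opNonSquare⇒half-length-gap {σ} w {i} {j}
  (_ , j<n , (u , v , x≡uv , |u|≡|v| , 0<|u| , f , _ , _ , f-increasing , v≐fu) , ¬square)
  = record
  { gap = subst (λ L′ → FirstOccurrenceGap L′ (length u)) (sym L≡)
                (increasing-image-gap u f f-increasing fu≢u rest)
  ; fragment-length = m≡|u|+|u|
  }
  where
    m : ℕ
    m = suc j ∸ i
    L rest : Word σ
    L = drop i (toList w)
    rest = drop m L
    v≡fu : v ≡ map f u
    v≡fu = Pointwise-graph⇒map v≐fu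
    fu≢u : map f u ≢ u
    fu≢u fu≡u = ¬square (u , (λ { refl → <-irrefl refl 0<|u| }) , trans x≡uv (cong (u ++_) (trans v≡fu fu≡u)))
    L≡ : L ≡ u ++ map f u ++ rest
    L≡ = begin
      L                     ≡⟨ take++drop≡id m L ⟨
      take m L ++ rest      ≡⟨ cong (_++ rest) x≡uv ⟩
      (u ++ v) ++ rest      ≡⟨ ++-assoc u v rest ⟩
      u ++ v ++ rest        ≡⟨ cong (λ z → u ++ z ++ rest) v≡fu ⟩
      u ++ map f u ++ rest  ∎
      where open ≡-Reasoning
    m≡|u|+|u| : m ≡ length u + length u
    m≡|u|+|u| = begin
      m                        ≡⟨ length-fragment w i j<n ⟨
      length (take m L)        ≡⟨ cong length x≡uv ⟩
      length (u ++ v)          ≡⟨ length-++ u ⟩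
      length u + length v      ≡⟨ cong (length u +_) |u|≡|v| ⟨
      length u + length u      ∎
      where open ≡-Reasoning

encode-gap : ∀ {σ n} (w : Vec (Fin σ) n) {i k} → i < n → FirstOccurrenceGap (drop i (toList w)) k → Fin (n * (σ C 2))
encode-gap w i<n g = combine (fromℕ< i<n) (pairIndex (FirstOccurrenceGap.lo<hi g))

encode-gap-injective : ∀ {σ n} (w : Vec (Fin σ) n) {i i′ k k′} (i<n : i < n) (i′<n : i′ < n)
  (g : FirstOccurrenceGap (drop i (toList w)) k) (g′ : FirstOccurrenceGap (drop i′ (toList w)) k′) →
  encode-gap w i<n g ≡ encode-gap w i′<n g′ → i ≡ i′ × k ≡ k′
encode-gap-injective w {i} {i′} i<n i′<n g g′ eq
  with start≡ , pair≡ ← combine-injective _ _ _ _ eq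
  with refl ← fromℕ<-injective i i′ i<n i′<n start≡
  with lo≡ , hi≡ ← pairIndex-injective (FirstOccurrenceGap.lo<hi g) (FirstOccurrenceGap.lo<hi g′) pair≡ =
  refl , gap-length-unique g g′ lo≡ hi≡

encode : ∀ {σ n} (w : Vec (Fin σ) n) {x} → OPNonSquareFragment w x → Fin (n * (σ C 2))
encode w {i , j} g@(i≤j , j<n , _) =
  encode-gap w (≤-<-trans i≤j j<n) (HalfLengthGap.gap (opNonSquare⇒half-length-gap w g))

encode-injective : ∀ {σ n} (w : Vec (Fin σ) n) {x y} (g : OPNonSquareFragment w x) (g′ : OPNonSquareFragment w y) →
  encode w g ≡ encode w g′ → x ≡ y
encode-injective w {i , j} {i′ , j′} g@(i≤j , j<n , _) g′@(i′≤j′ , j′<n , _) eq =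
  cong₂ _,_ i≡i′ (suc-injective (∸-cancelʳ-≡ i≤1+j (subst (_≤ suc j′) (sym i≡i′) (m≤n⇒m≤1+n i′≤j′)) (begin
    suc j ∸ i           ≡⟨ H.fragment-length ⟩
    H.half + H.half     ≡⟨ cong₂ _+_ half≡half′ half≡half′ ⟩
    H′.half + H′.half   ≡⟨ H′.fragment-length ⟨
    suc j′ ∸ i′         ≡⟨ cong (suc j′ ∸_) i≡i′ ⟨
    suc j′ ∸ i          ∎)))
  where
    module H = HalfLengthGap (opNonSquare⇒half-length-gap w g)
    module H′ = HalfLengthGap (opNonSquare⇒half-length-gap w g′)
    same-start-and-half : i ≡ i′ × H.half ≡ H′.half
    same-start-and-half = encode-gap-injective w (≤-<-trans i≤j j<n) (≤-<-trans i′≤j′ j′<n) H.gap H′.gap eq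
    i≡i′ : i ≡ i′
    i≡i′ = proj₁ same-start-and-half
    i≤1+j : i ≤ suc j
    i≤1+j = m≤n⇒m≤1+n i≤j
    half≡half′ : H.half ≡ H′.half
    half≡half′ = proj₂ same-start-and-half
    open ≡-Reasoning

corollary18 : (σ n : ℕ) (w : Vec (Fin σ) n) (ps : List (ℕ × ℕ)) → Unique ps →
    All (λ { (i , j) → i ≤ j × j < n × OPSquare (fragment w i j) × ¬ Square (fragment w i j) }) ps →
    length ps ≤ (σ C 2) * n
corollary18 σ n w ps ps-unique ps-good =
  subst (length ps ≤_) (*-comm n (σ C 2))
    (length≤-of-injective-code (encode w) (encode-injective w) ps-unique (All-map (λ { {i , j} g → g }) ps-good))
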